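{- Let $P$ be a CLS pattern with $P\rhd(\Theta;\langle\Phi,\Psi\rangle;\Xi)$, and let $\mathsf m$ be a type mapping which satisfies $\Xi$. Then $\mathsf m(\Theta)\vdash P:\langle\mathsf m(\Phi),\mathsf m(\Psi)\rangle$.
   Context: CLS syntax. Fix an alphabet $\mathcal{E}$ of element symbols $a,b,\dots$. Sequences $S ::= \epsilon \mid a \mid S\cdot S$; terms $T ::= S \mid (S)^L\rfloor T \mid T\,|\,T$ ($(S)^L\rfloor T$ is a membrane $S$ containing $T$). Patterns additionally allow term variables $X,\dots$, sequence variables $\tilde x,\dots$ and element variables $x,\dots$: $P ::= SP \mid (SP)^L\rfloor P \mid P\,|\,P \mid X$, $SP ::= \epsilon\mid a\mid SP\cdot SP\mid \tilde x\mid x$. Types. Fix an assignment $\Gamma$ of a basic type to each element of $\mathcal{E}$ (written $a:t\in\Gamma$). For each basic type $t$ there are fixed sets $R_t$ and $E_t$ of basic types with $t\notin R_t\cup E_t$, $R_t\cap E_t=\emptyset$. For a set $\mathtt P$ of basic types let $\overline{E}(\mathtt P)=\bigcup_{t\in\mathtt P}E_t$. A type is a pair $\langle\mathtt P,\mathtt R\rangle$ of sets of basic types; it is well formed if $\mathtt P\cap\overline E(\mathtt P)=\mathtt P\cap\mathtt R=\mathtt R\cap\overline E(\mathtt P)=\emptyset$. Well-formed types $\langle\mathtt P,\mathtt R\rangle,\langle\mathtt P',\mathtt R'\rangle$ are compatible, $\langle\mathtt P,\mathtt R\rangle\bowtie\langle\mathtt P',\mathtt R'\rangle$, if $\overline E(\mathtt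 P)\cap\mathtt P'=\overline E(\mathtt P)\cap\mathtt R'=\overline E(\mathtt P')\cap\mathtt P=\overline E(\mathtt P')\cap\mathtt R=\emptyset$; their conjunction is $\langle\mathtt P\cup\mathtt P',(\mathtt R\cup\mathtt R')\setminus(\mathtt P\cup\mathtt P')\rangle$. A basis $\Delta$ assigns to element variables types $\langle\{t\},R_t\rangle$ and to term/sequence variables types $\langle\mathtt P,\mathtt R\rangle$. Typing rules for $\Delta\vdash P:\langle\mathtt P,\mathtt R\rangle$: $\Delta,\rho:\langle\mathtt P,\mathtt R\rangle\vdash\rho:\langle\mathtt P,\mathtt R\rangle$; $\Delta\vdash\epsilon:\langle\emptyset,\emptyset\rangle$; if $a:t\in\Gamma$ then $\Delta\vdash a:\langle\{t\},R_t\rangle$; if $\Delta\vdash SP:\tau$, $\Delta\vdash SP':\tau'$ and $\tau\bowtie\tau'$ then $SP\cdot SP'$ gets the conjunction of $\tau,\tau'$; likewise for $P\,|\,P'$; if $\Delta\vdash SP:\langle\mathtt P,\mathtt R\rangle$, $\Delta\vdash P:\langle\mathtt P',\mathtt R'\rangle$, these are compatible and $\mathtt R'\subseteq\mathtt P$, then $\Delta\vdash (SP)^L\rfloor P:\langle\mathtt P,\mathtt R\setminus\mathtt P'\rangle$. Type inference. To each element variable $x$ associate an e-type variable $\varphi_x$ (ranging over basic types) and an r-type variable $\psi_x$; to each term or sequence variable $\eta$ associate a p-type variable $\phi_\eta$ and an r-type variable $\psi_\eta$ (ranging over sets of basic types). $\Phi,\Psi$ range over formal set expressions built with $\cup$ and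 $\setminus$ from finite sets of basic types, singletons $\{\varphi_x\}$, p- and r-type variables, and expressions $R_{\varphi_x}$. A basis scheme $\Theta$ maps element variables $x$ to $\langle\varphi_x,\psi_x\rangle$ and term/sequence variables $\eta$ to $\langle\phi_\eta,\psi_\eta\rangle$. Constraints are formal equalities, inclusions and compatibilities $\langle\Phi,\Psi\rangle\bowtie\langle\Phi',\Psi'\rangle$. The judgement $P\rhd(\Theta;\langle\Phi,\Psi\rangle;\Xi)$ is derived by: $\epsilon\rhd(\emptyset;\langle\emptyset,\emptyset\rangle;\emptyset)$; if $a:t\in\Gamma$ then $a\rhd(\emptyset;\langle\{t\},R_t\rangle;\emptyset)$; $x\rhd(\{x:\langle\varphi_x,\psi_x\rangle\};\langle\{\varphi_x\},\psi_x\rangle;\{\psi_x=R_{\varphi_x}\})$; $\eta\rhd(\{\eta:\langle\phi_\eta,\psi_\eta\rangle\};\langle\phi_\eta,\psi_\eta\rangle;\emptyset)$; if $A\rhd(\Theta;\langle\Phi,\Psi\rangle;\Xi)$ and $B\rhd(\Theta';\langle\Phi',\Psi'\rangle;\Xi')$, with $A\circ B$ being $SP\cdot SP'$ or $P\,|\,P'$, then $A\circ B\rhd(\Theta\cup\Theta';\langle\Phi\cup\Phi',(\Psi\cup\Psi')\setminus(\Phi\cup\Phi')\rangle;\Xi\cup\Xi'\cup\{\langle\Phi,\Psi\rangle\bowtie\langle\Phi',\Psi'\rangle\})$; if $SP\rhd(\Theta;\langle\Phi,\Psi\rangle;\Xi)$ and $P\rhd(\Theta';\langle\Phi',\Psi'\rangle;\Xi')$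 then $(SP)^L\rfloor P\rhd(\Theta\cup\Theta';\langle\Phi,\Psi\setminus\Phi'\rangle;\Xi\cup\Xi'\cup\{\langle\Phi,\Psi\rangle\bowtie\langle\Phi',\Psi'\rangle,\ \Psi'\subseteq\Phi\})$. A type mapping $\mathsf m$ maps e-type variables to basic types and p-/r-type variables to sets of basic types; it extends to expressions by substitution ($\{\varphi_x\}\mapsto\{\mathsf m(\varphi_x)\}$, $R_{\varphi_x}\mapsto R_{\mathsf m(\varphi_x)}$) and evaluation of $\cup,\setminus$, and to basis schemes by $\mathsf m(\Theta)=\{x:\langle\{\mathsf m(\varphi_x)\},\mathsf m(\psi_x)\rangle\}\cup\{\eta:\langle\mathsf m(\phi_\eta),\mathsf m(\psi_\eta)\rangle\}$. $\mathsf m$ satisfies $\Xi$ if every constraint of $\Xi$ holds after applying $\mathsf m$ (equalities and inclusions as set relations, $\bowtie$ meaning both types are well formed and compatible). -}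

module Defs where

open import Level using (0ℓ)
open import Data.Nat using (ℕ)
import Data.Nat.Properties as ℕP
open import Data.Product using (Σ; _×_; _,_; ∃)
open import Data.List using (List; []; _∷_; _++_)
open import Data.List.Membership.Propositional using (_∈_)
open import Data.Maybe using (Maybe; just; nothing)
open import Relation.Nullary using (¬_; yes; no)
open import Relation.Binary.PropositionalEquality using (_≡_; refl; cong)
open import Relation.Binary.Definitions using (DecidableEquality)
open import Relation.Unary using (Pred; ∅; ｛_｝; _⊆_; _∪_; _∩_; _∖_; _≐_; Empty)

record Setting : Set₁ where
  field
    Elem  : Set
    BT    : Set
    Γ     : Elem → BT                -- a : t ∈ Γ  iff  Γ a ≡ t
    R     : BT → Pred BT 0ℓ
    E     : BT → Pred BT 0ℓ
    t∉Rt  : ∀ t → ¬ R t t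
    t∉Et  : ∀ t → ¬ E t t
    Rt∩Et : ∀ t → Empty (R t ∩ E t)

data Var : Set where
  evar : ℕ → Var
  svar : ℕ → Var
  tvar : ℕ → Var

_≟V_ : DecidableEquality Var
evar m ≟V evar n with m ℕP.≟ n
... | yes p = yes (cong evar p)
... | no ¬p = no λ { refl → ¬p refl }
evar _ ≟V svar _ = no λ ()
evar _ ≟V tvar _ = no λ ()
svar _ ≟V evar _ = no λ ()
svar m ≟V svar n with m ℕP.≟ n
... | yes p = yes (cong svar p)
... | no ¬p = no λ { refl → ¬p refl }
svar _ ≟V tvar _ = no λ ()
tvar _ ≟V evar _ = no λ ()
tvar _ ≟V svar _ = no λ ()
tvar m ≟V tvar n with m ℕP.≟ n
... | yes p = yes (cong tvar p)
... | no ¬p = no λ { refl → ¬p refl }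

module CLS (S : Setting) where
  open Setting S

  -- Patterns (the looping label L carries no information for typing)

  infixr 6 _·_
  infixr 5 _∣_
  data SPat : Set where
    ε    : SPat
    el   : Elem → SPat
    _·_  : SPat → SPat → SPat
    sv   : ℕ → SPat
    ev   : ℕ → SPat

  data Pat : Set where
    seq  : SPat → Pat
    mem  : SPat → Pat → Pat         -- (SP)^L ⌋ P
    _∣_  : Pat → Pat → Pat
    tv   : ℕ → Pat

  BSet : Set₁
  BSet = Pred BT 0ℓ

  record Ty : Set₁ where
    constructor ⟨_,_⟩
    field
      Pp : BSet
      Rr : BSet
  open Ty public

  Ebar : BSet → BSet
  Ebar P u = Σ BT λ t → P t × E t u

  WF : Ty → Set
  WF ⟨ P , Rs ⟩ = Empty (P ∩ Ebar P) × Empty (P ∩ Rs) × Empty (Rs ∩ Ebar P)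

  _⋈_ : Ty → Ty → Set
  ⟨ P , Rs ⟩ ⋈ ⟨ P' , Rs' ⟩ =
    WF ⟨ P , Rs ⟩ × WF ⟨ P' , Rs' ⟩ ×
    Empty (Ebar P ∩ P') × Empty (Ebar P ∩ Rs') ×
    Empty (Ebar P' ∩ P) × Empty (Ebar P' ∩ Rs)

  conj : Ty → Ty → Ty
  conj ⟨ P , Rs ⟩ ⟨ P' , Rs' ⟩ = ⟨ P ∪ P' , (Rs ∪ Rs') ∖ (P ∪ P') ⟩

  Basis : Set₁
  Basis = Var → Maybe Ty

  infix 4 _⊢ˢ_∶_ _⊢_∶_

  data _⊢ˢ_∶_ (Δ : Basis) : SPat → Ty → Set₁ where
    t-svar : ∀ {n τ} → Δ (svar n) ≡ just τ → Δ ⊢ˢ sv n ∶ τ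
    t-evar : ∀ {n τ} → Δ (evar n) ≡ just τ → Δ ⊢ˢ ev n ∶ τ
    t-eps  : Δ ⊢ˢ ε ∶ ⟨ ∅ , ∅ ⟩
    t-el   : ∀ {a t} → Γ a ≡ t → Δ ⊢ˢ el a ∶ ⟨ ｛ t ｝ , R t ⟩
    t-cat  : ∀ {s s' τ τ'} → Δ ⊢ˢ s ∶ τ → Δ ⊢ˢ s' ∶ τ' → τ ⋈ τ' →
             Δ ⊢ˢ s · s' ∶ conj τ τ'

  data _⊢_∶_ (Δ : Basis) : Pat → Ty → Set₁ where
    t-tvar : ∀ {n τ} → Δ (tvar n) ≡ just τ → Δ ⊢ tv n ∶ τ
    t-seq  : ∀ {s τ} → Δ ⊢ˢ s ∶ τ → Δ ⊢ seq s ∶ τ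
    t-par  : ∀ {p p' τ τ'} → Δ ⊢ p ∶ τ → Δ ⊢ p' ∶ τ' → τ ⋈ τ' →
             Δ ⊢ p ∣ p' ∶ conj τ τ'
    t-mem  : ∀ {s p P Rs P' Rs'} → Δ ⊢ˢ s ∶ ⟨ P , Rs ⟩ → Δ ⊢ p ∶ ⟨ P' , Rs' ⟩ →
             ⟨ P , Rs ⟩ ⋈ ⟨ P' , Rs' ⟩ → Rs' ⊆ P →
             Δ ⊢ mem s p ∶ ⟨ P , Rs ∖ P' ⟩

  -- Type inference: formal set expressions, constraints, schemes.
  -- φ_x (e-type var of element var x)  : written  sngφ (evar-index)
  -- φ_η (p-type var of seq/term var η) : phi η
  -- ψ_v (r-type var of any variable v)  : psi v
  -- R_{φ_x}                             : Rφ x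

  infixl 6 _∪ₑ_ _∖ₑ_
  infix 4 _≐ₑ_ _⊆ₑ_
  data SExp : Set where
    lit  : List BT → SExp
    emp  : SExp
    sng  : BT → SExp
    Rc   : BT → SExp
    sngφ : ℕ → SExp
    Rφ   : ℕ → SExp
    phi  : Var → SExp
    psi  : Var → SExp
    _∪ₑ_ : SExp → SExp → SExp
    _∖ₑ_ : SExp → SExp → SExp

  data Constraint : Set where
    _≐ₑ_ : SExp → SExp → Constraint
    _⊆ₑ_ : SExp → SExp → Constraint
    compat : SExp → SExp → SExp → SExp → Constraint

  -- A basis scheme maps each variable v occurring in it to its own type
  -- variables (⟨φ_x,ψ_x⟩ resp. ⟨φ_η,ψ_η⟩); it is thus determined by the
  -- list of variables in its domain.
  Scheme : Set
  Scheme = List Var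

  infix 3 _▷_ _▷ˢ_

  data _▷ˢ_ : SPat → Scheme × SExp × SExp × List Constraint → Set where
    i-eps  : ε ▷ˢ ([] , emp , emp , [])
    i-el   : ∀ {a t} → Γ a ≡ t → el a ▷ˢ ([] , sng t , Rc t , [])
    i-evar : ∀ {x} → ev x ▷ˢ (evar x ∷ [] , sngφ x , psi (evar x) ,
                              (psi (evar x) ≐ₑ Rφ x) ∷ [])
    i-svar : ∀ {n} → sv n ▷ˢ (svar n ∷ [] , phi (svar n) , psi (svar n) , [])
    i-cat  : ∀ {s s' Θ Φ Ψ Ξ Θ' Φ' Ψ' Ξ'} →
             s ▷ˢ (Θ , Φ , Ψ , Ξ) → s' ▷ˢ (Θ' , Φ' , Ψ' , Ξ') →
             s · s' ▷ˢ (Θ ++ Θ' , Φ ∪ₑ Φ' , (Ψ ∪ₑ Ψ') ∖ₑ (Φ ∪ₑ Φ') ,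
                        Ξ ++ Ξ' ++ (compat Φ Ψ Φ' Ψ' ∷ []))

  data _▷_ : Pat → Scheme × SExp × SExp × List Constraint → Set where
    i-tvar : ∀ {n} → tv n ▷ (tvar n ∷ [] , phi (tvar n) , psi (tvar n) , [])
    i-seq  : ∀ {s r} → s ▷ˢ r → seq s ▷ r
    i-par  : ∀ {p p' Θ Φ Ψ Ξ Θ' Φ' Ψ' Ξ'} →
             p ▷ (Θ , Φ , Ψ , Ξ) → p' ▷ (Θ' , Φ' , Ψ' , Ξ') →
             p ∣ p' ▷ (Θ ++ Θ' , Φ ∪ₑ Φ' , (Ψ ∪ₑ Ψ') ∖ₑ (Φ ∪ₑ Φ') ,
                       Ξ ++ Ξ' ++ (compat Φ Ψ Φ' Ψ' ∷ []))
    i-mem  : ∀ {s p Θ Φ Ψ Ξ Θ' Φ' Ψ' Ξ'} →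
             s ▷ˢ (Θ , Φ , Ψ , Ξ) → p ▷ (Θ' , Φ' , Ψ' , Ξ') →
             mem s p ▷ (Θ ++ Θ' , Φ , Ψ ∖ₑ Φ' ,
                        Ξ ++ Ξ' ++ (compat Φ Ψ Φ' Ψ' ∷ (Ψ' ⊆ₑ Φ) ∷ []))

  record TyMap : Set₁ where
    field
      eφ : ℕ → BT
      pφ : Var → BSet
      rψ : Var → BSet
  open TyMap public

  ⟦_⟧ : SExp → TyMap → BSet
  ⟦ lit l ⟧    m = λ t → t ∈ l
  ⟦ emp ⟧      m = ∅
  ⟦ sng t ⟧    m = ｛ t ｝
  ⟦ Rc t ⟧     m = R t
  ⟦ sngφ x ⟧   m = ｛ eφ m x ｝
  ⟦ Rφ x ⟧     m = R (eφ m x)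
  ⟦ phi v ⟧    m = pφ m v
  ⟦ psi v ⟧    m = rψ m v
  ⟦ e ∪ₑ e' ⟧  m = ⟦ e ⟧ m ∪ ⟦ e' ⟧ m
  ⟦ e ∖ₑ e' ⟧  m = ⟦ e ⟧ m ∖ ⟦ e' ⟧ m

  holds : TyMap → Constraint → Set
  holds m (e ≐ₑ e')          = ⟦ e ⟧ m ≐ ⟦ e' ⟧ m
  holds m (e ⊆ₑ e')          = ⟦ e ⟧ m ⊆ ⟦ e' ⟧ m
  holds m (compat Φ Ψ Φ' Ψ') = ⟨ ⟦ Φ ⟧ m , ⟦ Ψ ⟧ m ⟩ ⋈ ⟨ ⟦ Φ' ⟧ m , ⟦ Ψ' ⟧ m ⟩

  Satisfies : TyMap → List Constraint → Set
  Satisfies m Ξ = ∀ {c} → c ∈ Ξ → holds m c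

  mEntry : TyMap → Var → Ty
  mEntry m (evar x) = ⟨ ｛ eφ m x ｝ , rψ m (evar x) ⟩
  mEntry m (svar n) = ⟨ pφ m (svar n) , rψ m (svar n) ⟩
  mEntry m (tvar n) = ⟨ pφ m (tvar n) , rψ m (tvar n) ⟩

  mBasis : TyMap → Scheme → Basis
  mBasis m [] v = nothing
  mBasis m (w ∷ Θ) v with v ≟V w
  ... | yes _ = just (mEntry m v)
  ... | no  _ = mBasis m Θ v

module Submission where

-- The side conditions
-- of the typing rules (compatibility, Ψ' ⊆ Φ) are exactly the constraints the
-- inference rule adds, so they are read off from the hypothesis that m
-- satisfies Ξ.  The only real work is in the bases: a compound pattern is
-- inferred with the scheme Θ ++ Θ', while its parts are typed in m(Θ) and
-- m(Θ').  Since m(Θ) gives every variable v in Θ the same type, mEntry m v,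
-- independently of where v occurs, m(Θ) grows monotonically with Θ
-- (mBasis-mono), and typing is preserved under extension of the basis
-- (weakening).

open import Defs
open import Data.Product using (_×_; _,_)
open import Data.List using (List; []; _∷_; _++_)
open import Data.List.Membership.Propositional using (_∈_)
open import Data.List.Membership.Propositional.Properties using (∈-++⁺ˡ; ∈-++⁺ʳ)
open import Data.List.Relation.Binary.Subset.Propositional using (_⊆_)
open import Data.List.Relation.Binary.Subset.Propositional.Properties using (xs⊆xs++ys; xs⊆ys++xs)
open import Data.List.Relation.Unary.Any using (here; there)
open import Data.Maybe using (just)
open import Data.Maybe.Properties using (just-injective)
open import Relation.Nullary using (yes; no; contradiction)
open import Relation.Binary.PropositionalEquality using (_≡_; refl)

module Soundness (S : Setting) where
  open CLS S

  _⊑_ : Basis → Basis → Set₁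
  Δ ⊑ Δ' = ∀ {v τ} → Δ v ≡ just τ → Δ' v ≡ just τ

  weakenˢ : ∀ {Δ Δ' s τ} → Δ ⊑ Δ' → Δ ⊢ˢ s ∶ τ → Δ' ⊢ˢ s ∶ τ
  weakenˢ Δ⊑Δ' (t-svar x)     = t-svar (Δ⊑Δ' x)
  weakenˢ Δ⊑Δ' (t-evar x)     = t-evar (Δ⊑Δ' x)
  weakenˢ Δ⊑Δ' t-eps          = t-eps
  weakenˢ Δ⊑Δ' (t-el x)       = t-el x
  weakenˢ Δ⊑Δ' (t-cat d d' c) = t-cat (weakenˢ Δ⊑Δ' d) (weakenˢ Δ⊑Δ' d') c

  weaken : ∀ {Δ Δ' p τ} → Δ ⊑ Δ' → Δ ⊢ p ∶ τ → Δ' ⊢ p ∶ τ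
  weaken Δ⊑Δ' (t-tvar x)       = t-tvar (Δ⊑Δ' x)
  weaken Δ⊑Δ' (t-seq d)        = t-seq (weakenˢ Δ⊑Δ' d)
  weaken Δ⊑Δ' (t-par d d' c)   = t-par (weaken Δ⊑Δ' d) (weaken Δ⊑Δ' d') c
  weaken Δ⊑Δ' (t-mem d d' c i) = t-mem (weakenˢ Δ⊑Δ' d) (weaken Δ⊑Δ' d') c i

  mBasis-sound : ∀ m Θ {v τ} → mBasis m Θ v ≡ just τ → v ∈ Θ × mEntry m v ≡ τ
  mBasis-sound m []      ()
  mBasis-sound m (w ∷ Θ) {v} eq with v ≟V w
  ... | yes v≡w = here v≡w , just-injective eq
  ... | no  _   with mBasis-sound m Θ eq
  ...   | v∈Θ , entry≡τ = there v∈Θ , entry≡τ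

  mBasis-complete : ∀ m Θ {v} → v ∈ Θ → mBasis m Θ v ≡ just (mEntry m v)
  mBasis-complete m (w ∷ Θ) {v} v∈wΘ with v ≟V w | v∈wΘ
  ... | yes _   | _          = refl
  ... | no  v≢w | here v≡w   = contradiction v≡w v≢w
  ... | no  _   | there v∈Θ  = mBasis-complete m Θ v∈Θ

  mBasis-mono : ∀ m {Θ Θ'} → Θ ⊆ Θ' → mBasis m Θ ⊑ mBasis m Θ'
  mBasis-mono m {Θ} {Θ'} Θ⊆Θ' eq with mBasis-sound m Θ eq
  ... | v∈Θ , refl = mBasis-complete m Θ' (Θ⊆Θ' v∈Θ)

  mBasis-self : ∀ m v → mBasis m (v ∷ []) v ≡ just (mEntry m v)
  mBasis-self m v = mBasis-complete m (v ∷ []) (here refl)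

  split-satisfies : ∀ {m} Ξ Ξ' {Ξ''} → Satisfies m (Ξ ++ Ξ' ++ Ξ'') →
                    Satisfies m Ξ × Satisfies m Ξ' × Satisfies m Ξ''
  split-satisfies Ξ Ξ' sat =
    (λ c∈Ξ   → sat (∈-++⁺ˡ c∈Ξ)) ,
    (λ c∈Ξ'  → sat (∈-++⁺ʳ Ξ (∈-++⁺ˡ c∈Ξ'))) ,
    (λ c∈Ξ'' → sat (∈-++⁺ʳ Ξ (∈-++⁺ʳ Ξ' c∈Ξ'')))

  soundˢ : ∀ {s Θ Φ Ψ Ξ} m → s ▷ˢ (Θ , Φ , Ψ , Ξ) → Satisfies m Ξ →
           mBasis m Θ ⊢ˢ s ∶ ⟨ ⟦ Φ ⟧ m , ⟦ Ψ ⟧ m ⟩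
  soundˢ m i-eps         _   = t-eps
  soundˢ m (i-el Γa≡t)   _   = t-el Γa≡t
  soundˢ m (i-evar {x})  _   = t-evar (mBasis-self m (evar x))
  soundˢ m (i-svar {n})  _   = t-svar (mBasis-self m (svar n))
  soundˢ m (i-cat {Θ = Θ} {Ξ = Ξ} {Θ' = Θ'} {Ξ' = Ξ'} d d') sat
    with split-satisfies Ξ Ξ' sat
  ... | satΞ , satΞ' , side =
    t-cat (weakenˢ (mBasis-mono m (xs⊆xs++ys Θ Θ')) (soundˢ m d satΞ))
          (weakenˢ (mBasis-mono m (xs⊆ys++xs Θ' Θ)) (soundˢ m d' satΞ'))
          (side (here refl))

  sound : ∀ {p Θ Φ Ψ Ξ} m → p ▷ (Θ , Φ , Ψ , Ξ) → Satisfies m Ξ →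
          mBasis m Θ ⊢ p ∶ ⟨ ⟦ Φ ⟧ m , ⟦ Ψ ⟧ m ⟩
  sound m (i-tvar {n}) _   = t-tvar (mBasis-self m (tvar n))
  sound m (i-seq d)    sat = t-seq (soundˢ m d sat)
  sound m (i-par {Θ = Θ} {Ξ = Ξ} {Θ' = Θ'} {Ξ' = Ξ'} d d') sat
    with split-satisfies Ξ Ξ' sat
  ... | satΞ , satΞ' , side =
    t-par (weaken (mBasis-mono m (xs⊆xs++ys Θ Θ')) (sound m d satΞ))
          (weaken (mBasis-mono m (xs⊆ys++xs Θ' Θ)) (sound m d' satΞ'))
          (side (here refl))
  sound m (i-mem {Θ = Θ} {Ξ = Ξ} {Θ' = Θ'} {Ξ' = Ξ'} d d') sat
    with split-satisfies Ξ Ξ' sat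
  ... | satΞ , satΞ' , side =
    t-mem (weakenˢ (mBasis-mono m (xs⊆xs++ys Θ Θ')) (soundˢ m d satΞ))
          (weaken (mBasis-mono m (xs⊆ys++xs Θ' Θ)) (sound m d' satΞ'))
          (side (here refl))
          (side (there (here refl)))

mainTheorem2 : (S : Setting) → let open CLS S in
    (P : Pat) (Θ : Scheme) (Φ Ψ : SExp) (Ξ : List Constraint) (m : TyMap) →
    P ▷ (Θ , Φ , Ψ , Ξ) → Satisfies m Ξ →
    mBasis m Θ ⊢ P ∶ ⟨ ⟦ Φ ⟧ m , ⟦ Ψ ⟧ m ⟩
mainTheorem2 S P Θ Φ Ψ Ξ m = Soundness.sound S m
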